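{- Let $D$ be a $3$-anti-circulant digraph such that every proper induced subdigraph of $D$ satisfies the BE-property, and let $S$ be a maximum stable set of $D$. If $D\in\mathfrak{D}$ and $B^{\pm}$ is not a stable set, then $D$ admits an $S_{BE}$-path partition.
   Context: Digraphs are finite, loopless, without multiple arcs (digons allowed); $u\to v$ means $uv$ is an arc. A stable set is a set of pairwise non-adjacent vertices. For a maximum stable set $S$: $B^+$ is the set of vertices $v\notin S$ such that no vertex of $S$ dominates $v$; $B^-$ is the set of vertices $v\notin S$ that dominate no vertex of $S$; $B^{\pm}=V(D)\setminus(S\cup B^+\cup B^-)$. A path partition is a collection of vertex-disjoint (directed) paths covering $V(D)$; an $S_{BE}$-path partition is a path partition in which each path contains exactly one vertex of $S$ and that vertex is the first or last vertex of the path. A digraph satisfies the BE-property if for every maximum stable set $S$ it admits an $S_{BE}$-path partition. An anti-$P_4$ is a set of four distinct vertices with $v_1\to v_2$, $v_3\to v_2$, $v_3\to v_4$; $D$ is $3$-anti-circulant if for every such anti-$P_4$, $v_4\to v_1$. A blocking odd cycle is a digraph whose underlying simple graph is a cycle $x_1x_2\dots x_{2k+1}x_1$, $k\ge1$, with $x_1$ a source and $x_2$ a sink; $\mathfrak{D}$ is the class of digraphs containing no induced subdigraph that is a blocking odd cycle. -}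

module Defs where

open import Data.Nat using (ℕ; zero; suc; _+_; _*_; _≤_; _%_)
open import Data.Bool using (Bool; true; false)
open import Data.Fin using (Fin; toℕ) renaming (zero to fzero; suc to fsuc)
open import Data.Fin.Subset using (Subset; _∈_; _∉_; _⊆_; _⊂_; ⊤; ∣_∣)
open import Data.Fin.Subset.Properties using (_∈?_)
open import Data.List using (List; []; _∷_; _∷ʳ_; concat; filter; length)
open import Data.List.Relation.Unary.All using (All)
open import Data.List.Relation.Unary.Unique.Propositional using (Unique)
import Data.List.Membership.Propositional as LM
open import Data.Product using (Σ; ∃; ∃-syntax; _×_; _,_)
open import Data.Sum using (_⊎_)
open import Data.Unit using () renaming (⊤ to Unit)
open import Relation.Nullary using (¬_)
open import Relation.Binary.PropositionalEquality using (_≡_; _≢_)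
open import Function.Definitions using (Injective)

-- A finite loopless digraph on vertex set Fin n (no multiple arcs, digons allowed).
record Digraph (n : ℕ) : Set where
  field
    arc      : Fin n → Fin n → Bool
    loopless : ∀ v → arc v v ≡ false

module _ {n : ℕ} (D : Digraph n) where
  open Digraph D

  _⇒_ : Fin n → Fin n → Set
  u ⇒ v = arc u v ≡ true

  -- Induced subdigraphs are represented by their vertex set X ⊆ V(D);
  -- all notions below are relative to the subdigraph D[X].

  Stable : Subset n → Set
  Stable S = ∀ u v → u ∈ S → v ∈ S → ¬ (u ⇒ v)

  MaxStableIn : Subset n → Subset n → Set
  MaxStableIn X S = S ⊆ X × Stable S × (∀ T → T ⊆ X → Stable T → ∣ T ∣ ≤ ∣ S ∣)

  Consec : List (Fin n) → Set
  Consec []           = Unit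
  Consec (x ∷ [])     = Unit
  Consec (x ∷ y ∷ r)  = (x ⇒ y) × Consec (y ∷ r)

  -- a directed path (nonempty; distinctness of vertices is imposed by the partition)
  IsPath : List (Fin n) → Set
  IsPath P = P ≢ [] × Consec P

  PathPartition : Subset n → List (List (Fin n)) → Set
  PathPartition X Ps =
    All IsPath Ps × Unique (concat Ps) ×
    (∀ v → (v LM.∈ concat Ps → v ∈ X) × (v ∈ X → v LM.∈ concat Ps))

  SBEPath : Subset n → List (Fin n) → Set
  SBEPath S P =
    length (filter (_∈? S) P) ≡ 1 ×
    (∃[ s ] s ∈ S × ∃[ r ] (P ≡ s ∷ r ⊎ P ≡ r ∷ʳ s))

  SBEPathPartition : Subset n → Subset n → List (List (Fin n)) → Set
  SBEPathPartition X S Ps = PathPartition X Ps × All (SBEPath S) Ps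

  BEProperty : Subset n → Set
  BEProperty X = ∀ S → MaxStableIn X S → ∃[ Ps ] SBEPathPartition X S Ps

  AntiCirculant3 : Set
  AntiCirculant3 = ∀ v₁ v₂ v₃ v₄ →
    v₁ ≢ v₂ → v₁ ≢ v₃ → v₁ ≢ v₄ → v₂ ≢ v₃ → v₂ ≢ v₄ → v₃ ≢ v₄ →
    v₁ ⇒ v₂ → v₃ ⇒ v₂ → v₃ ⇒ v₄ → v₄ ⇒ v₁

  CycAdj : (m : ℕ) → Fin (suc m) → Fin (suc m) → Set
  CycAdj m i j = toℕ j ≡ (toℕ i + 1) % suc m ⊎ toℕ i ≡ (toℕ j + 1) % suc m

  -- an induced subdigraph of D which is a blocking odd cycle x₁ … x_{2k+1},
  -- k = j + 1 ≥ 1, with x₁ (index 0) a source and x₂ (index 1) a sink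
  InducedBlockingOddCycle : Set
  InducedBlockingOddCycle =
    ∃[ j ] Σ (Fin (3 + 2 * j) → Fin n) λ x →
      Injective _≡_ _≡_ x ×
      (∀ a b → ((x a ⇒ x b ⊎ x b ⇒ x a) → CycAdj (2 + 2 * j) a b) ×
               (CycAdj (2 + 2 * j) a b → (x a ⇒ x b ⊎ x b ⇒ x a))) ×
      (∀ a → ¬ (x a ⇒ x fzero)) ×
      (∀ a → ¬ (x (fsuc fzero) ⇒ x a))

  InFrakD : Set
  InFrakD = ¬ InducedBlockingOddCycle

  InBpm : Subset n → Fin n → Set
  InBpm S v = v ∉ S × (∃[ s ] s ∈ S × s ⇒ v) × (∃[ s ] s ∈ S × v ⇒ s)

  BpmStable : Subset n → Set
  BpmStable S = ∀ u v → InBpm S u → InBpm S v → ¬ (u ⇒ v)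

-- Pick an arc u → v inside B^±. Anti-circulance forces the S-neighbours of u and v to
-- meet: there is t ∈ S with u → t → v. If v → t, take an S_BE-path partition of D − v
-- (S is still a maximum stable set there) and insert v right after u; anti-circulance
-- makes v dominate the successor of u. Otherwise take a partition of D − u and insert u
-- right before v, which works unless the predecessor of v is t and t ↛ u. In that case
-- either v → u and u goes right after v, or u, v, t induce a blocking triangle, which
-- D ∈ 𝔇 excludes. A vertex outside S inserted next to a vertex outside S leaves the
-- S-vertex of its path at an end.
module Submission where

open import Defs
open import Data.Nat using (ℕ)
open import Data.Fin.Subset using (Subset; _⊂_; ⊤; _∈_; _∉_; ∁; ⁅_⁆)
open import Data.Product using (∃-syntax; ∃₂; _×_; _,_; proj₁; proj₂; map₂)
open import Relation.Nullary using (¬_; Dec; yes; no)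

open import Data.Bool using (true) renaming (_≟_ to _≟ᵇ_)
open import Data.Empty using (⊥-elim)
open import Data.Fin using (Fin) renaming (zero to fzero; suc to fsuc)
open import Data.Fin.Properties using (any?) renaming (_≟_ to _≟ᶠ_)
open import Data.Fin.Subset.Properties
  using (_∈?_; ∈⊤; x∈∁p⇒x∉p; x∉p⇒x∈∁p; x≢y⇒x∉⁅y⁆; x∉⁅y⁆⇒x≢y)
open import Data.List
  using (List; []; _∷_; _++_; _∷ʳ_; [_]; concat; filter; length; head; last; initLast; _∷ʳ′_)
open import Data.List.Properties
  using (++-assoc; ++-identityʳ; concat-++; filter-++; filter-reject; ∷-injectiveˡ; ∷ʳ-injectiveʳ)
open import Data.List.Relation.Unary.All as All using (All; []; _∷_)
open import Data.List.Relation.Unary.Any using (here; there)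
open import Data.List.Relation.Unary.AllPairs using (_∷_)
open import Data.List.Membership.Propositional using () renaming (_∈_ to _∈ₗ_)
open import Data.List.Membership.Propositional.Properties
  using (∈-++⁺ˡ; ∈-++⁺ʳ; ∈-∃++; ∈-concat⁻′; ∈-concat⁺′; ∈-filter⁺)
open import Data.List.Relation.Binary.Permutation.Propositional
  using (_↭_; ↭-sym; ↭⇒↭ₛ; module PermutationReasoning)
open import Data.List.Relation.Binary.Permutation.Propositional.Properties using (shift; ∈-resp-↭)
import Data.List.Relation.Binary.Permutation.Setoid.Properties as Permutationₛ
open import Data.Maybe using (just; nothing)
open import Data.Maybe.Properties using (just-injective)
open import Data.Maybe.Relation.Unary.All as Maybe using (just; nothing) renaming (All to MAll)
open import Data.Sum using (_⊎_; inj₁; inj₂)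
open import Data.Unit using (tt)
open import Function using (case_of_)
open import Relation.Nullary.Decidable using (_×-dec_; ¬?)
open import Relation.Binary.PropositionalEquality
  using (_≡_; _≢_; refl; sym; trans; cong; subst; ≢-sym; setoid; module ≡-Reasoning)

last-∷ʳ : ∀ {A : Set} (xs : List A) x → last (xs ∷ʳ x) ≡ just x
last-∷ʳ []           x = refl
last-∷ʳ (y ∷ [])     x = refl
last-∷ʳ (y ∷ z ∷ xs) x = last-∷ʳ (z ∷ xs) x

length≡1⇒∈-unique : ∀ {A : Set} {xs : List A} {a b} →
                    length xs ≡ 1 → a ∈ₗ xs → b ∈ₗ xs → a ≡ b
length≡1⇒∈-unique {xs = _ ∷ []} _ (here refl) (here refl) = refl

insert-keeps-last : ∀ {A : Set} (xs ys : List A) {x r s} → ys ≢ [] →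
                    xs ++ ys ≡ r ∷ʳ s → ∃[ r′ ] xs ++ x ∷ ys ≡ r′ ∷ʳ s
insert-keeps-last xs ys {x} ys≢[] eq with initLast ys
... | []        = ⊥-elim (ys≢[] refl)
... | ys′ ∷ʳ′ y with ∷ʳ-injectiveʳ (xs ++ ys′) _ (trans (++-assoc xs ys′ [ y ]) eq)
...   | refl = xs ++ x ∷ ys′ , sym (++-assoc xs (x ∷ ys′) [ y ])

All-++-∷-map : ∀ {A : Set} {P : A → Set} xs {x x′ ys} →
               (P x → P x′) → All P (xs ++ x ∷ ys) → All P (xs ++ x′ ∷ ys)
All-++-∷-map []       f (px ∷ pys) = f px ∷ pys
All-++-∷-map (_ ∷ xs) f (px ∷ ps)  = px ∷ All-++-∷-map xs f ps

concat-++-∷ : ∀ {A : Set} xss yss (xs ys : List A) →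
              concat (xss ++ (xs ++ ys) ∷ yss) ≡ (concat xss ++ xs) ++ ys ++ concat yss
concat-++-∷ xss yss xs ys = begin
  concat (xss ++ (xs ++ ys) ∷ yss)        ≡⟨ concat-++ xss _ ⟨
  concat xss ++ (xs ++ ys) ++ concat yss  ≡⟨ cong (concat xss ++_) (++-assoc xs ys _) ⟩
  concat xss ++ xs ++ ys ++ concat yss    ≡⟨ ++-assoc (concat xss) xs _ ⟨
  (concat xss ++ xs) ++ ys ++ concat yss  ∎
  where open ≡-Reasoning

concat-insert-↭ : ∀ {A : Set} xss yss (xs ys : List A) x →
                  concat (xss ++ (xs ++ x ∷ ys) ∷ yss) ↭ x ∷ concat (xss ++ (xs ++ ys) ∷ yss)
concat-insert-↭ xss yss xs ys x = begin
  concat (xss ++ (xs ++ x ∷ ys) ∷ yss)         ≡⟨ concat-++-∷ xss yss xs (x ∷ ys) ⟩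
  (concat xss ++ xs) ++ x ∷ ys ++ concat yss   ↭⟨ shift x (concat xss ++ xs) _ ⟩
  x ∷ (concat xss ++ xs) ++ ys ++ concat yss   ≡⟨ cong (x ∷_) (concat-++-∷ xss yss xs ys) ⟨
  x ∷ concat (xss ++ (xs ++ ys) ∷ yss)         ∎
  where open PermutationReasoning

module _ {n : ℕ} where

  ∈∁⁅⁆⇒≢ : ∀ {x v : Fin n} → v ∈ ∁ ⁅ x ⁆ → v ≢ x
  ∈∁⁅⁆⇒≢ v∈ = x∉⁅y⁆⇒x≢y (x∈∁p⇒x∉p v∈)

  ≢⇒∈∁⁅⁆ : ∀ {x v : Fin n} → v ≢ x → v ∈ ∁ ⁅ x ⁆
  ≢⇒∈∁⁅⁆ v≢x = x∉p⇒x∈∁p (x≢y⇒x∉⁅y⁆ v≢x)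

  ∁⁅⁆⊂⊤ : (x : Fin n) → ∁ ⁅ x ⁆ ⊂ ⊤
  ∁⁅⁆⊂⊤ x = (λ _ → ∈⊤) , x , ∈⊤ , λ x∈ → ∈∁⁅⁆⇒≢ x∈ refl

  ∈∉⇒≢ : ∀ {S : Subset n} {u v} → u ∈ S → v ∉ S → u ≢ v
  ∈∉⇒≢ u∈S v∉S refl = v∉S u∈S

module Theory {n : ℕ} (D : Digraph n) where

  infix 4 _⟶_
  _⟶_ : Fin n → Fin n → Set
  _⟶_ = _⇒_ D

  _⟶?_ : ∀ u v → Dec (u ⟶ v)
  u ⟶? v = Digraph.arc D u v ≟ᵇ true

  ⟶⇒≢ : ∀ {u v} → u ⟶ v → u ≢ v
  ⟶⇒≢ {u} u⟶u refl with trans (sym u⟶u) (Digraph.loopless D u)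
  ... | ()

  consec-∷⁻ : ∀ {x xs} → Consec D (x ∷ xs) → Consec D xs
  consec-∷⁻ {xs = []}    _       = tt
  consec-∷⁻ {xs = _ ∷ _} (_ , c) = c

  consec-insert : ∀ xs ys {x} → Consec D (xs ++ ys) →
                  MAll (_⟶ x) (last xs) → MAll (x ⟶_) (head ys) → Consec D (xs ++ x ∷ ys)
  consec-insert []           []       _       _          _          = tt
  consec-insert []           (_ ∷ _)  c       _          (just x⟶y) = x⟶y , c
  consec-insert (_ ∷ [])     ys       c       (just a⟶x) out        =
    a⟶x , consec-insert [] ys (consec-∷⁻ c) nothing out
  consec-insert (_ ∷ _ ∷ xs) ys       (a⟶b , c) into    out       =
    a⟶b , consec-insert (_ ∷ xs) ys c into out

  consec-into : ∀ xs {y ys} → Consec D (xs ++ y ∷ ys) → MAll (λ a → a ⟶ y × a ∈ₗ xs) (last xs)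
  consec-into []           _         = nothing
  consec-into (_ ∷ [])     (a⟶y , _) = just (a⟶y , here refl)
  consec-into (_ ∷ _ ∷ xs) (_ , c)   = Maybe.map (map₂ there) (consec-into (_ ∷ xs) c)

  consec-out : ∀ xs {y ys} → Consec D (xs ++ y ∷ ys) → MAll (λ b → y ⟶ b × b ∈ₗ ys) (head ys)
  consec-out []       {ys = []}    _         = nothing
  consec-out []       {ys = _ ∷ _} (y⟶b , _) = just (y⟶b , here refl)
  consec-out (_ ∷ xs) c                     = consec-out xs (consec-∷⁻ c)

  blocking-triangle : ∀ {u v t} → u ⟶ v → u ⟶ t → t ⟶ v →
                      ¬ t ⟶ u → ¬ v ⟶ u → ¬ v ⟶ t → InducedBlockingOddCycle D
  blocking-triangle {u} {v} {t} u⟶v u⟶t t⟶v t↛u v↛u v↛t =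
    0 , x , injective , adjacent , source , sink
    where
    x : Fin 3 → Fin n
    x fzero               = u
    x (fsuc fzero)        = v
    x (fsuc (fsuc fzero)) = t
    injective : ∀ {a b} → x a ≡ x b → a ≡ b
    injective {fzero}               {fzero}               _ = refl
    injective {fzero}               {fsuc fzero}          e = ⊥-elim (⟶⇒≢ u⟶v e)
    injective {fzero}               {fsuc (fsuc fzero)}   e = ⊥-elim (⟶⇒≢ u⟶t e)
    injective {fsuc fzero}          {fzero}               e = ⊥-elim (⟶⇒≢ u⟶v (sym e))
    injective {fsuc fzero}          {fsuc fzero}          _ = refl
    injective {fsuc fzero}          {fsuc (fsuc fzero)}   e = ⊥-elim (⟶⇒≢ t⟶v (sym e))
    injective {fsuc (fsuc fzero)}   {fzero}               e = ⊥-elim (⟶⇒≢ u⟶t (sym e))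
    injective {fsuc (fsuc fzero)}   {fsuc fzero}          e = ⊥-elim (⟶⇒≢ t⟶v e)
    injective {fsuc (fsuc fzero)}   {fsuc (fsuc fzero)}   _ = refl
    no-loop : ∀ a → ¬ (x a ⟶ x a ⊎ x a ⟶ x a)
    no-loop a (inj₁ p) = ⟶⇒≢ p refl
    no-loop a (inj₂ p) = ⟶⇒≢ p refl
    adjacent : ∀ a b → ((x a ⟶ x b ⊎ x b ⟶ x a) → CycAdj D 2 a b) ×
                       (CycAdj D 2 a b → (x a ⟶ x b ⊎ x b ⟶ x a))
    adjacent fzero               fzero               =
      (λ p → ⊥-elim (no-loop fzero p)) , λ { (inj₁ ()) ; (inj₂ ()) }
    adjacent fzero               (fsuc fzero)        = (λ _ → inj₁ refl) , λ _ → inj₁ u⟶v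
    adjacent fzero               (fsuc (fsuc fzero)) = (λ _ → inj₂ refl) , λ _ → inj₁ u⟶t
    adjacent (fsuc fzero)        fzero               = (λ _ → inj₂ refl) , λ _ → inj₂ u⟶v
    adjacent (fsuc fzero)        (fsuc fzero)        =
      (λ p → ⊥-elim (no-loop (fsuc fzero) p)) , λ { (inj₁ ()) ; (inj₂ ()) }
    adjacent (fsuc fzero)        (fsuc (fsuc fzero)) = (λ _ → inj₁ refl) , λ _ → inj₂ t⟶v
    adjacent (fsuc (fsuc fzero)) fzero               = (λ _ → inj₁ refl) , λ _ → inj₂ u⟶t
    adjacent (fsuc (fsuc fzero)) (fsuc fzero)        = (λ _ → inj₂ refl) , λ _ → inj₁ t⟶v
    adjacent (fsuc (fsuc fzero)) (fsuc (fsuc fzero)) =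
      (λ p → ⊥-elim (no-loop (fsuc (fsuc fzero)) p)) , λ { (inj₁ ()) ; (inj₂ ()) }
    source : ∀ a → ¬ x a ⟶ x fzero
    source fzero               p = ⟶⇒≢ p refl
    source (fsuc fzero)        p = v↛u p
    source (fsuc (fsuc fzero)) p = t↛u p
    sink : ∀ a → ¬ x (fsuc fzero) ⟶ x a
    sink fzero               p = v↛u p
    sink (fsuc fzero)        p = ⟶⇒≢ p refl
    sink (fsuc (fsuc fzero)) p = v↛t p

  module AntiCirculant (anti-circulant : AntiCirculant3 D) where

    anti-P4 : ∀ {v₁ v₂ v₃ v₄} → v₁ ≢ v₃ → v₁ ≢ v₄ → v₂ ≢ v₄ →
              v₁ ⟶ v₂ → v₃ ⟶ v₂ → v₃ ⟶ v₄ → v₄ ⟶ v₁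
    anti-P4 v₁≢v₃ v₁≢v₄ v₂≢v₄ v₁⟶v₂ v₃⟶v₂ v₃⟶v₄ =
      anti-circulant _ _ _ _ (⟶⇒≢ v₁⟶v₂) v₁≢v₃ v₁≢v₄ (≢-sym (⟶⇒≢ v₃⟶v₂)) v₂≢v₄ (⟶⇒≢ v₃⟶v₄)
                     v₁⟶v₂ v₃⟶v₂ v₃⟶v₄

    dominates-out-neighbours : ∀ {z p q x} → z ⟶ p → z ⟶ q → q ⟶ p →
                               z ⟶ x → x ≢ p → x ≢ q → p ⟶ x
    dominates-out-neighbours z⟶p z⟶q q⟶p z⟶x x≢p x≢q =
      anti-P4 (≢-sym (⟶⇒≢ z⟶x)) x≢p (⟶⇒≢ q⟶p) x⟶q z⟶q z⟶p
      where x⟶q = anti-P4 (≢-sym (⟶⇒≢ z⟶q)) (≢-sym x≢q) (≢-sym x≢p) q⟶p z⟶p z⟶x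

    in-neighbours-dominate : ∀ {z p q x} → p ⟶ z → q ⟶ z → p ⟶ q →
                             x ⟶ z → x ≢ p → x ≢ q → x ⟶ p
    in-neighbours-dominate p⟶z q⟶z p⟶q x⟶z x≢p x≢q =
      anti-P4 (⟶⇒≢ p⟶q) (≢-sym x≢p) (≢-sym (⟶⇒≢ x⟶z)) p⟶z q⟶z q⟶x
      where q⟶x = anti-P4 x≢p x≢q (≢-sym (⟶⇒≢ q⟶z)) x⟶z p⟶z p⟶q

    anti-P4-stable-ends : ∀ {S s t u v} → Stable D S → s ∈ S → t ∈ S → u ∉ S → v ∉ S →
                          s ⟶ v → u ⟶ v → u ⟶ t → s ≡ t
    anti-P4-stable-ends {s = s} {t} stable s∈S t∈S u∉S v∉S s⟶v u⟶v u⟶t with s ≟ᶠ t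
    ... | yes s≡t = s≡t
    ... | no s≢t  = ⊥-elim (stable t s t∈S s∈S
                      (anti-P4 (∈∉⇒≢ s∈S u∉S) s≢t (≢-sym (∈∉⇒≢ t∈S v∉S)) s⟶v u⟶v u⟶t))

  module _ (S : Subset n) where

    NextTo : Fin n → List (Fin n) → List (Fin n) → Set
    NextTo y xs ys = last xs ≡ just y ⊎ head ys ≡ just y

    filter-insert : ∀ (xs ys : List (Fin n)) {x} → x ∉ S →
                    filter (_∈? S) (xs ++ x ∷ ys) ≡ filter (_∈? S) (xs ++ ys)
    filter-insert xs ys {x} x∉S = begin
      filter (_∈? S) (xs ++ x ∷ ys)                  ≡⟨ filter-++ (_∈? S) xs _ ⟩
      filter (_∈? S) xs ++ filter (_∈? S) (x ∷ ys)   ≡⟨ cong (filter (_∈? S) xs ++_) (filter-reject (_∈? S) x∉S) ⟩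
      filter (_∈? S) xs ++ filter (_∈? S) ys         ≡⟨ filter-++ (_∈? S) xs ys ⟨
      filter (_∈? S) (xs ++ ys)                      ∎
      where open ≡-Reasoning

    sbe-insert : ∀ (xs ys : List (Fin n)) {x y} → x ∉ S → y ∉ S → NextTo y xs ys →
                 SBEPath D S (xs ++ ys) → SBEPath D S (xs ++ x ∷ ys)
    sbe-insert xs ys {x} {y} x∉S y∉S next (count , s , s∈S , r , ends) =
      trans (cong length (filter-insert xs ys x∉S)) count , s , s∈S , ends′ xs ys next ends
      where
      ends′ : ∀ (xs ys : List (Fin n)) → NextTo y xs ys → xs ++ ys ≡ s ∷ r ⊎ xs ++ ys ≡ r ∷ʳ s →
              ∃[ r′ ] (xs ++ x ∷ ys ≡ s ∷ r′ ⊎ xs ++ x ∷ ys ≡ r′ ∷ʳ s)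
      ends′ (_ ∷ xs) ys _ (inj₁ eq) with ∷-injectiveˡ eq
      ... | refl = xs ++ x ∷ ys , inj₁ refl
      ends′ [] ys (inj₂ y-head) (inj₁ eq) =
        ⊥-elim (∈∉⇒≢ s∈S y∉S (just-injective (trans (sym (cong head eq)) y-head)))
      ends′ xs [] (inj₁ y-last) (inj₂ eq) rewrite ++-identityʳ xs | eq =
        ⊥-elim (∈∉⇒≢ s∈S y∉S (just-injective (trans (sym (last-∷ʳ r s)) y-last)))
      ends′ xs (g ∷ ys) _ (inj₂ eq) =
        let r′ , eq′ = insert-keeps-last xs (g ∷ ys) (λ ()) eq in r′ , inj₂ eq′

    sbe-S-unique : ∀ {Q a b} → SBEPath D S Q → a ∈ₗ Q → b ∈ₗ Q → a ∈ S → b ∈ S → a ≡ b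
    sbe-S-unique (count , _) a∈Q b∈Q a∈S b∈S =
      length≡1⇒∈-unique count (∈-filter⁺ (_∈? S) a∈Q a∈S) (∈-filter⁺ (_∈? S) b∈Q b∈S)

    insert-vertex : ∀ Ps₁ Ps₂ (xs ys : List (Fin n)) {x y} → x ∉ S → y ∉ S → NextTo y xs ys →
                    MAll (_⟶ x) (last xs) → MAll (x ⟶_) (head ys) →
                    SBEPathPartition D (∁ ⁅ x ⁆) S (Ps₁ ++ (xs ++ ys) ∷ Ps₂) →
                    SBEPathPartition D ⊤ S (Ps₁ ++ (xs ++ x ∷ ys) ∷ Ps₂)
    insert-vertex Ps₁ Ps₂ xs ys {x} x∉S y∉S next into out ((paths , unique , covers) , sbes) =
      ( All-++-∷-map Ps₁ (λ (_ , c) → nonempty xs , consec-insert xs ys c into out) paths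
      , Unique-resp-↭ (↭⇒↭ₛ (↭-sym perm)) (All.tabulate x≢ ∷ unique)
      , λ v → (λ _ → ∈⊤) , λ _ → ∈-resp-↭ (↭-sym perm) (covered v) )
      , All-++-∷-map Ps₁ (sbe-insert xs ys x∉S y∉S next) sbes
      where
      open Permutationₛ (setoid (Fin n)) using (Unique-resp-↭)
      perm = concat-insert-↭ Ps₁ Ps₂ xs ys x
      nonempty : ∀ (zs : List (Fin n)) → zs ++ x ∷ ys ≢ []
      nonempty []      ()
      nonempty (_ ∷ _) ()
      x≢ : ∀ {w} → w ∈ₗ concat (Ps₁ ++ (xs ++ ys) ∷ Ps₂) → x ≢ w
      x≢ w∈ = ≢-sym (∈∁⁅⁆⇒≢ (proj₁ (covers _) w∈))
      covered : ∀ v → v ∈ₗ x ∷ concat (Ps₁ ++ (xs ++ ys) ∷ Ps₂)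
      covered v with v ≟ᶠ x
      ... | yes v≡x = here v≡x
      ... | no v≢x  = there (proj₂ (covers v) (≢⇒∈∁⁅⁆ v≢x))

    InBpm? : ∀ w → Dec (InBpm D S w)
    InBpm? w = ¬? (w ∈? S) ×-dec any? (λ s → s ∈? S ×-dec s ⟶? w)
                           ×-dec any? (λ s → s ∈? S ×-dec w ⟶? s)

    ¬BpmStable⇒arc : ¬ BpmStable D S → ∃₂ λ u v → InBpm D S u × InBpm D S v × u ⟶ v
    ¬BpmStable⇒arc unstable with any? (λ u → any? (λ v → InBpm? u ×-dec InBpm? v ×-dec u ⟶? v))
    ... | yes (u , v , arc) = u , v , arc
    ... | no ∄arc           = ⊥-elim (unstable λ u v u∈ v∈ u⟶v → ∄arc (u , v , u∈ , v∈ , u⟶v))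

    maxStable-∁⁅⁆ : ∀ {x} → x ∉ S → MaxStableIn D ⊤ S → MaxStableIn D (∁ ⁅ x ⁆) S
    maxStable-∁⁅⁆ x∉S (_ , stable , maximum) =
      (λ w∈S → ≢⇒∈∁⁅⁆ (∈∉⇒≢ w∈S x∉S)) , stable , λ T _ → maximum T (λ _ → ∈⊤)

    record PartitionAround (x y : Fin n) : Set where
      field
        Ps₁ Ps₂   : List (List (Fin n))
        xs ys     : List (Fin n)
        partition : SBEPathPartition D (∁ ⁅ x ⁆) S (Ps₁ ++ (xs ++ y ∷ ys) ∷ Ps₂)

      path : List (Fin n)
      path = xs ++ y ∷ ys

      path∈partition : path ∈ₗ Ps₁ ++ path ∷ Ps₂
      path∈partition = ∈-++⁺ʳ Ps₁ (here refl)

      consec : Consec D path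
      consec = proj₂ (All.lookup (proj₁ (proj₁ partition)) path∈partition)

      sbe : SBEPath D S path
      sbe = All.lookup (proj₂ partition) path∈partition

      predecessor : MAll (λ a → a ⟶ y × a ∈ₗ path) (last xs)
      predecessor = Maybe.map (map₂ ∈-++⁺ˡ) (consec-into xs consec)

      successor : MAll (λ b → y ⟶ b × b ∈ₗ path) (head ys)
      successor = Maybe.map (map₂ (λ b∈ys → ∈-++⁺ʳ xs (there b∈ys))) (consec-out xs consec)

      avoids : ∀ {w} → w ∈ₗ path → w ≢ x
      avoids w∈ = ∈∁⁅⁆⇒≢ (proj₁ (proj₂ (proj₂ (proj₁ partition)) _) (∈-concat⁺′ w∈ path∈partition))

    module _ {x y} (P : PartitionAround x y) (x∉S : x ∉ S) (y∉S : y ∉ S) where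
      open PartitionAround P

      insert-before : MAll (_⟶ x) (last xs) → x ⟶ y → ∃[ Ps ] SBEPathPartition D ⊤ S Ps
      insert-before into x⟶y =
        _ , insert-vertex Ps₁ Ps₂ xs (y ∷ ys) x∉S y∉S (inj₂ refl) into (just x⟶y) partition

      insert-after : y ⟶ x → MAll (x ⟶_) (head ys) → ∃[ Ps ] SBEPathPartition D ⊤ S Ps
      insert-after y⟶x out =
        _ , insert-vertex Ps₁ Ps₂ (xs ∷ʳ y) ys x∉S y∉S (inj₁ (last-∷ʳ xs y))
              (subst (MAll (_⟶ x)) (sym (last-∷ʳ xs y)) (just y⟶x)) out
              (subst (λ Q → SBEPathPartition D (∁ ⁅ x ⁆) S (Ps₁ ++ Q ∷ Ps₂))
                     (sym (++-assoc xs [ y ] ys)) partition)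

    module _ (maximum : MaxStableIn D ⊤ S) (be : ∀ X → X ⊂ ⊤ → BEProperty D X) where

      partition-around : ∀ {x y} → x ∉ S → y ≢ x → PartitionAround x y
      partition-around {x} {y} x∉S y≢x
        with Ps , partition ← be (∁ ⁅ x ⁆) (∁⁅⁆⊂⊤ x) S (maxStable-∁⁅⁆ x∉S maximum)
        with P , y∈P , P∈Ps ← ∈-concat⁻′ Ps (proj₂ (proj₂ (proj₂ (proj₁ partition)) y) (≢⇒∈∁⁅⁆ y≢x))
        with Ps₁ , Ps₂ , refl ← ∈-∃++ P∈Ps
        with xs , ys , refl ← ∈-∃++ y∈P
        = record { Ps₁ = Ps₁ ; Ps₂ = Ps₂ ; xs = xs ; ys = ys ; partition = partition }

      module _ (anti-circulant : AntiCirculant3 D) where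
        open AntiCirculant anti-circulant

        S-stable : Stable D S
        S-stable = proj₁ (proj₂ maximum)

        common-S-neighbour : ∀ {u v} → InBpm D S u → InBpm D S v → u ⟶ v →
                             ∃[ t ] t ∈ S × u ⟶ t × t ⟶ v
        common-S-neighbour (u∉S , _ , t , t∈S , u⟶t) (v∉S , (t′ , t′∈S , t′⟶v) , _) u⟶v
          with refl ← anti-P4-stable-ends S-stable t′∈S t∈S u∉S v∉S t′⟶v u⟶v u⟶t
          = t , t∈S , u⟶t , t′⟶v

        module Configuration {u v t} (u∉S : u ∉ S) (v∉S : v ∉ S) (t∈S : t ∈ S)
                 (u⟶v : u ⟶ v) (u⟶t : u ⟶ t) (t⟶v : t ⟶ v) where

          partition-if-v⟶t : v ⟶ t → ∃[ Ps ] SBEPathPartition D ⊤ S Ps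
          partition-if-v⟶t v⟶t = insert-after P v∉S u∉S u⟶v (Maybe.map v⟶successor successor)
            where
            P = partition-around v∉S (⟶⇒≢ u⟶v)
            open PartitionAround P
            v⟶successor : ∀ {b} → u ⟶ b × b ∈ₗ path → v ⟶ b
            v⟶successor {b} (u⟶b , b∈) with b ≟ᶠ t
            ... | yes refl = v⟶t
            ... | no b≢t   = dominates-out-neighbours u⟶v u⟶t t⟶v u⟶b (avoids b∈) b≢t

          partition-if-v↛t : InBpm D S u → InBpm D S v → InFrakD D → ¬ v ⟶ t →
                             ∃[ Ps ] SBEPathPartition D ⊤ S Ps
          partition-if-v↛t (_ , (s₁ , s₁∈S , s₁⟶u) , _) (_ , _ , s₂ , s₂∈S , v⟶s₂) D∈𝔇 v↛t =
            by-predecessor (last xs) refl predecessor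
            where
            P = partition-around u∉S (≢-sym (⟶⇒≢ u⟶v))
            open PartitionAround P
            before : MAll (_⟶ u) (last xs) → ∃[ Ps ] SBEPathPartition D ⊤ S Ps
            before into = insert-before P u∉S v∉S into u⟶v
            u⟶successor : t ∈ₗ path → v ⟶ u → ∀ {w} → v ⟶ w × w ∈ₗ path → u ⟶ w
            u⟶successor t∈ v⟶u {w} (v⟶w , w∈) with w ∈? S
            ... | yes w∈S with refl ← sbe-S-unique sbe w∈ t∈ w∈S t∈S = ⊥-elim (v↛t v⟶w)
            ... | no w∉S
              with refl ← anti-P4-stable-ends S-stable s₁∈S s₂∈S v∉S u∉S s₁⟶u v⟶u v⟶s₂
              = dominates-out-neighbours v⟶u v⟶s₂ s₁⟶u v⟶w (avoids w∈) (≢-sym (∈∉⇒≢ s₁∈S w∉S))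
            by-predecessor : ∀ m → m ≡ last xs → MAll (λ a → a ⟶ v × a ∈ₗ path) m →
                             ∃[ Ps ] SBEPathPartition D ⊤ S Ps
            by-predecessor nothing  eq nothing = before (subst (MAll _) eq nothing)
            by-predecessor (just a) eq (just (a⟶v , a∈)) with a ≟ᶠ t | t ⟶? u | v ⟶? u
            ... | no a≢t   | _       | _ =
              before (subst (MAll _) eq (just (in-neighbours-dominate u⟶v t⟶v u⟶t a⟶v (avoids a∈) a≢t)))
            ... | yes refl | yes t⟶u | _ = before (subst (MAll _) eq (just t⟶u))
            ... | yes refl | no t↛u  | yes v⟶u =
              insert-after P u∉S v∉S v⟶u (Maybe.map (u⟶successor a∈ v⟶u) successor)
            ... | yes refl | no t↛u  | no v↛u =
              ⊥-elim (D∈𝔇 (blocking-triangle u⟶v u⟶t t⟶v t↛u v↛u v↛t))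

lemma17 : {n : ℕ} (D : Digraph n) → AntiCirculant3 D →
          (∀ X → X ⊂ ⊤ → BEProperty D X) →
          (S : Subset n) → MaxStableIn D ⊤ S →
          InFrakD D → ¬ BpmStable D S →
          ∃[ Ps ] SBEPathPartition D ⊤ S Ps
lemma17 D anti-circulant be S maximum D∈𝔇 unstable =
  let u , v , u∈B± , v∈B± , u⟶v = ¬BpmStable⇒arc S unstable
      t , t∈S , u⟶t , t⟶v = common-S-neighbour S maximum be anti-circulant u∈B± v∈B± u⟶v
      module Cases = Configuration S maximum be anti-circulant
                       (proj₁ u∈B±) (proj₁ v∈B±) t∈S u⟶v u⟶t t⟶v
  in case v ⟶? t of λ where
       (yes v⟶t) → Cases.partition-if-v⟶t v⟶t
       (no v↛t)  → Cases.partition-if-v↛t u∈B± v∈B± D∈𝔇 v↛t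
  where open Theory D
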